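{- Let $(A,B,C)$ be a set of $n$-sided dice. Then $(A,B,C)$ is balanced if and only if $\sum_{x\in A}x=\sum_{x\in B}x=\sum_{x\in C}x$.
   Context: Fix an integer $n>0$. A set of $n$-sided dice is an ordered triple $(A,B,C)$ of pairwise disjoint sets with $|A|=|B|=|C|=n$ and $A\cup B\cup C=\{1,2,\dots,3n\}$; each die is fair and dice are rolled independently. For dice $X,Y$, $P(X\succ Y)=\frac{1}{n^2}|\{(x,y)\in X\times Y: x>y\}|$ is the probability that the number rolled on $X$ exceeds that rolled on $Y$. The set of dice is balanced if $P(A\succ B)=P(B\succ C)=P(C\succ A)$. The sums $\sum_{x\in A}x$ etc. are called the face-sums of the dice. -}

module Defs where

open import Data.Nat using (ℕ; suc; _*_; NonZero)
open import Data.Nat.Properties using (_<?_; m*n≢0)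
open import Data.Fin using (Fin; toℕ)
open import Data.List using (List; length; filter; map; cartesianProduct; allFin)
open import Data.Nat.ListAction using (sum)
open import Data.Product using (_×_; proj₁; proj₂)
open import Data.Integer using (+_)
open import Data.Rational using (ℚ; _/_)
open import Relation.Binary.PropositionalEquality using (_≡_; _≢_; refl)
open import Relation.Binary.Definitions using (DecidableEquality)
open import Relation.Nullary using (yes; no)

data Die : Set where
  A B C : Die

_≟D_ : DecidableEquality Die
A ≟D A = yes refl
B ≟D B = yes refl
C ≟D C = yes refl
A ≟D B = no λ ()
A ≟D C = no λ ()
B ≟D A = no λ ()
B ≟D C = no λ ()
C ≟D A = no λ ()
C ≟D B = no λ ()

-- A labelling of {1,…,3n} by dice: the element i : Fin (3n) stands for the
-- number toℕ i + 1, and f i says which die carries it. Such a function is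
-- exactly a triple of pairwise disjoint sets with union {1,…,3n}.
Assignment : ℕ → Set
Assignment n = Fin (3 * n) → Die

faces : (n : ℕ) → Assignment n → Die → List ℕ
faces n f X = map (λ i → suc (toℕ i)) (filter (λ i → f i ≟D X) (allFin (3 * n)))

record IsDiceSet (n : ℕ) (f : Assignment n) : Set where
  field
    sizeA : length (faces n f A) ≡ n
    sizeB : length (faces n f B) ≡ n
    sizeC : length (faces n f C) ≡ n

wins : (n : ℕ) → Assignment n → Die → Die → ℕ
wins n f X Y = length (filter (λ p → proj₂ p <? proj₁ p)
                              (cartesianProduct (faces n f X) (faces n f Y)))

P≻ : (n : ℕ) .{{_ : NonZero n}} → Assignment n → Die → Die → ℚ
P≻ n f X Y = (+ wins n f X Y) / (n * n)
  where instance
    nz : NonZero (n * n)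
    nz = m*n≢0 n n

Balanced : (n : ℕ) .{{_ : NonZero n}} → Assignment n → Set
Balanced n f = (P≻ n f A B ≡ P≻ n f B C) × (P≻ n f B C ≡ P≻ n f C A)

faceSum : (n : ℕ) → Assignment n → Die → ℕ
faceSum n f X = sum (faces n f X)

EqualFaceSums : (n : ℕ) → Assignment n → Set
EqualFaceSums n f = (faceSum n f A ≡ faceSum n f B) × (faceSum n f B ≡ faceSum n f C)

-- Shift all faces down by one, so that the faces of a die are the 0-based positions of its
-- elements in {0,…,3n-1}. A face x of X equals the number of faces of all three dice below it,
-- so its face sum is  n(n-1)/2 + w(X,next X) + w(X,prev X), where w counts winning pairs; since
-- w(X,prev X) + w(prev X,X) = n², the face sum of X is a constant plus w(X,next X) - w(prev X,X).
-- Equal face sums therefore make the three cyclic differences of the win counts equal, and as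
-- they sum to zero they all vanish, which is balance; the converse is immediate.
module Submission where

open import Defs
open import Data.Bool using (true; false; if_then_else_)
open import Data.Empty using (⊥-elim)
open import Data.Fin as Fin using (Fin; toℕ)
import Data.Integer as ℤ
open import Data.List using (List; []; _∷_; _++_; length; filter; map; cartesianProduct; allFin; tabulate)
open import Data.List.Properties using (filter-++; length-++; length-map; map-∘; map-tabulate)
open import Data.Nat using (ℕ; NonZero; zero; suc; _+_; _*_; _<_)
open import Data.Nat.ListAction using (sum)
open import Data.Nat.Properties using (_<?_; m*n≢0; +-commutativeSemigroup; +-identityʳ; *-identityˡ; +-cancelˡ-≡; +-cancelʳ-≡; *-cancelˡ-≡; *-cancelʳ-≡)
open import Algebra.Properties.CommutativeSemigroup +-commutativeSemigroup using (x∙yz≈y∙xz)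
open import Data.Nat.Tactic.RingSolver using (solve-∀)
open import Data.Product using (_×_; _,_; proj₁; proj₂)
open import Data.Product.Function.NonDependent.Propositional using (_×-⇔_)
open import Data.Rational using (_/_)
open import Data.Rational.Properties using (normalize-injective-≃)
open import Function using (_∘_; id)
open import Function.Bundles using (_⇔_; mk⇔)
open import Function.Construct.Composition using (_⇔-∘_)
open import Relation.Binary.Definitions using (DecidableEquality)
open import Relation.Binary.PropositionalEquality
open import Relation.Nullary using (Dec; yes; no; does)
open import Relation.Unary using (Decidable)

open ≡-Reasoning

filter-map : ∀ {A B : Set} {P : B → Set} (P? : Decidable P) (f : A → B) xs →
             filter P? (map f xs) ≡ map f (filter (P? ∘ f) xs)
filter-map P? f [] = refl
filter-map P? f (x ∷ xs) with does (P? (f x))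
... | true  = cong (f x ∷_) (filter-map P? f xs)
... | false = filter-map P? f xs

below : ℕ → List ℕ → ℕ
below x ys = length (filter (_<? x) ys)

beats : List ℕ → List ℕ → ℕ
beats []       ys = 0
beats (x ∷ xs) ys = below x ys + beats xs ys

length-filter-cartesianProduct : ∀ xs ys →
  length (filter (λ p → proj₂ p <? proj₁ p) (cartesianProduct xs ys)) ≡ beats xs ys
length-filter-cartesianProduct []       ys = refl
length-filter-cartesianProduct (x ∷ xs) ys = begin
  length (filter P? (map (x ,_) ys ++ cartesianProduct xs ys))
    ≡⟨ cong length (filter-++ P? (map (x ,_) ys) _) ⟩
  length (filter P? (map (x ,_) ys) ++ filter P? (cartesianProduct xs ys))
    ≡⟨ length-++ (filter P? (map (x ,_) ys)) ⟩
  length (filter P? (map (x ,_) ys)) + length (filter P? (cartesianProduct xs ys))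
    ≡⟨ cong₂ _+_ x-row (length-filter-cartesianProduct xs ys) ⟩
  below x ys + beats xs ys ∎
  where
  P? : (p : ℕ × ℕ) → Dec (proj₂ p < proj₁ p)
  P? p = proj₂ p <? proj₁ p
  x-row : length (filter P? (map (x ,_) ys)) ≡ below x ys
  x-row = trans (cong length (filter-map P? (x ,_) ys)) (length-map (x ,_) (filter (_<? x) ys))

below-map-suc : ∀ x ys → below (suc x) (map suc ys) ≡ below x ys
below-map-suc x []       = refl
below-map-suc x (y ∷ ys) with does (y <? x)
... | true  = cong suc (below-map-suc x ys)
... | false = below-map-suc x ys

below-zero : ∀ ys → below 0 ys ≡ 0
below-zero []       = refl
below-zero (y ∷ ys) = below-zero ys

beats-map-suc : ∀ xs ys → beats (map suc xs) (map suc ys) ≡ beats xs ys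
beats-map-suc []       ys = refl
beats-map-suc (x ∷ xs) ys = cong₂ _+_ (below-map-suc x ys) (beats-map-suc xs ys)

beats-zeroˡ : ∀ xs ys → beats (0 ∷ xs) ys ≡ beats xs ys
beats-zeroˡ xs ys = cong (_+ beats xs ys) (below-zero ys)

beats-map-suc-zeroʳ : ∀ xs ys → beats (map suc xs) (0 ∷ ys) ≡ length xs + beats (map suc xs) ys
beats-map-suc-zeroʳ []       ys = refl
beats-map-suc-zeroʳ (x ∷ xs) ys = begin
  suc (below (suc x) ys) + beats (map suc xs) (0 ∷ ys)
    ≡⟨ cong (suc (below (suc x) ys) +_) (beats-map-suc-zeroʳ xs ys) ⟩
  suc (below (suc x) ys) + (length xs + beats (map suc xs) ys)
    ≡⟨ cong suc (x∙yz≈y∙xz (below (suc x) ys) (length xs) _) ⟩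
  suc (length xs + (below (suc x) ys + beats (map suc xs) ys)) ∎

sum-map-suc : ∀ xs → sum (map suc xs) ≡ length xs + sum xs
sum-map-suc []       = refl
sum-map-suc (x ∷ xs) = begin
  suc x + sum (map suc xs)      ≡⟨ cong (suc x +_) (sum-map-suc xs) ⟩
  suc x + (length xs + sum xs)  ≡⟨ cong suc (x∙yz≈y∙xz x (length xs) (sum xs)) ⟩
  suc (length xs + (x + sum xs)) ∎

triangle : ℕ → ℕ
triangle zero    = 0
triangle (suc n) = n + triangle n

module Labelling {L : Set} (_≟_ : DecidableEquality L) where

  ranks : (m : ℕ) → (Fin m → L) → L → List ℕ
  ranks m g X = map toℕ (filter (λ i → g i ≟ X) (allFin m))

  δ : L → L → ℕ
  δ l X = if does (l ≟ X) then 1 else 0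

  -- the ranks of label X after a new smallest element labelled l is added
  push : L → L → List ℕ → List ℕ
  push l X xs = if does (l ≟ X) then 0 ∷ map suc xs else map suc xs

  ranks-suc-tail : ∀ m (g : Fin (suc m) → L) X →
    map toℕ (filter (λ i → g i ≟ X) (tabulate Fin.suc)) ≡ map suc (ranks m (g ∘ Fin.suc) X)
  ranks-suc-tail m g X = begin
    map toℕ (filter P? (tabulate Fin.suc))
      ≡⟨ cong (map toℕ ∘ filter P?) (map-tabulate id Fin.suc) ⟨
    map toℕ (filter P? (map Fin.suc (allFin m)))
      ≡⟨ cong (map toℕ) (filter-map P? Fin.suc (allFin m)) ⟩
    map toℕ (map Fin.suc later)
      ≡⟨ map-∘ later ⟨
    map (suc ∘ toℕ) later
      ≡⟨ map-∘ later ⟩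
    map suc (map toℕ later) ∎
    where
    P? : (i : Fin (suc m)) → Dec (g i ≡ X)
    P? i = g i ≟ X
    later : List (Fin m)
    later = filter (P? ∘ Fin.suc) (allFin m)

  ranks-suc : ∀ m (g : Fin (suc m) → L) X →
              ranks (suc m) g X ≡ push (g Fin.zero) X (ranks m (g ∘ Fin.suc) X)
  ranks-suc m g X with g Fin.zero ≟ X
  ... | yes _ = cong (0 ∷_) (ranks-suc-tail m g X)
  ... | no  _ = ranks-suc-tail m g X

  length-push : ∀ l X xs → length (push l X xs) ≡ δ l X + length xs
  length-push l X xs with l ≟ X
  ... | yes _ = cong suc (length-map suc xs)
  ... | no  _ = length-map suc xs

  sum-push : ∀ l X xs → sum (push l X xs) ≡ length xs + sum xs
  sum-push l X xs with l ≟ X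
  ... | yes _ = sum-map-suc xs
  ... | no  _ = sum-map-suc xs

  beats-pushˡ : ∀ l X xs zs → beats (push l X xs) zs ≡ beats (map suc xs) zs
  beats-pushˡ l X xs zs with l ≟ X
  ... | yes _ = beats-zeroˡ (map suc xs) zs
  ... | no  _ = refl

  beats-pushʳ : ∀ l Y xs ys → beats (map suc xs) (push l Y ys) ≡ δ l Y * length xs + beats xs ys
  beats-pushʳ l Y xs ys with l ≟ Y
  ... | yes _ = begin
    beats (map suc xs) (0 ∷ map suc ys)        ≡⟨ beats-map-suc-zeroʳ xs (map suc ys) ⟩
    length xs + beats (map suc xs) (map suc ys) ≡⟨ cong₂ _+_ (sym (+-identityʳ (length xs))) (beats-map-suc xs ys) ⟩
    1 * length xs + beats xs ys ∎
  ... | no  _ = beats-map-suc xs ys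

  beats-push : ∀ l X Y xs ys → beats (push l X xs) (push l Y ys) ≡ δ l Y * length xs + beats xs ys
  beats-push l X Y xs ys = trans (beats-pushˡ l X xs (push l Y ys)) (beats-pushʳ l Y xs ys)

  δ-disjoint : ∀ l {X Y} → X ≢ Y → δ l X * δ l Y ≡ 0
  δ-disjoint l {X} {Y} X≢Y with l ≟ X | l ≟ Y
  ... | yes refl | yes refl = ⊥-elim (X≢Y refl)
  ... | yes _    | no  _    = refl
  ... | no  _    | _        = refl

  triangle-δ : ∀ l X n → triangle (δ l X + n) ≡ δ l X * n + triangle n
  triangle-δ l X n with l ≟ X
  ... | yes _ = cong (_+ triangle n) (sym (+-identityʳ n))
  ... | no  _ = refl

  beats-push-complement : ∀ l {X Y} xs ys → X ≢ Y →
    beats xs ys + beats ys xs ≡ length xs * length ys →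
    beats (push l X xs) (push l Y ys) + beats (push l Y ys) (push l X xs)
      ≡ length (push l X xs) * length (push l Y ys)
  beats-push-complement l {X} {Y} xs ys X≢Y complement = begin
    beats (push l X xs) (push l Y ys) + beats (push l Y ys) (push l X xs)
      ≡⟨ cong₂ _+_ (beats-push l X Y xs ys) (beats-push l Y X ys xs) ⟩
    (dY * a + beats xs ys) + (dX * b + beats ys xs)
      ≡⟨ regroup (dY * a) (dX * b) (beats xs ys) (beats ys xs) ⟩
    dY * a + dX * b + (beats xs ys + beats ys xs)
      ≡⟨ cong (dY * a + dX * b +_) complement ⟩
    dY * a + dX * b + a * b
      ≡⟨ cong (_+ (dY * a + dX * b + a * b)) (δ-disjoint l X≢Y) ⟨
    dX * dY + (dY * a + dX * b + a * b)
      ≡⟨ expand dX dY a b ⟨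
    (dX + a) * (dY + b)
      ≡⟨ cong₂ _*_ (length-push l X xs) (length-push l Y ys) ⟨
    length (push l X xs) * length (push l Y ys) ∎
    where
    a b dX dY : ℕ
    a = length xs
    b = length ys
    dX = δ l X
    dY = δ l Y
    regroup : ∀ p q u v → (p + u) + (q + v) ≡ p + q + (u + v)
    regroup = solve-∀
    expand : ∀ dX dY a b → (dX + a) * (dY + b) ≡ dX * dY + (dY * a + dX * b + a * b)
    expand = solve-∀

  beats-push-self : ∀ l X xs → beats xs xs ≡ triangle (length xs) →
    beats (push l X xs) (push l X xs) ≡ triangle (length (push l X xs))
  beats-push-self l X xs self = begin
    beats (push l X xs) (push l X xs)         ≡⟨ beats-push l X X xs xs ⟩
    δ l X * length xs + beats xs xs           ≡⟨ cong (δ l X * length xs +_) self ⟩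
    δ l X * length xs + triangle (length xs)  ≡⟨ triangle-δ l X (length xs) ⟨
    triangle (δ l X + length xs)              ≡⟨ cong triangle (length-push l X xs) ⟨
    triangle (length (push l X xs)) ∎

  beats-ranks-complement : ∀ m g {X Y} → X ≢ Y →
    beats (ranks m g X) (ranks m g Y) + beats (ranks m g Y) (ranks m g X)
      ≡ length (ranks m g X) * length (ranks m g Y)
  beats-ranks-complement zero    g X≢Y = refl
  beats-ranks-complement (suc m) g {X} {Y} X≢Y
    rewrite ranks-suc m g X | ranks-suc m g Y =
      beats-push-complement (g Fin.zero) _ _ X≢Y (beats-ranks-complement m (g ∘ Fin.suc) X≢Y)

  beats-ranks-self : ∀ m g X → beats (ranks m g X) (ranks m g X) ≡ triangle (length (ranks m g X))
  beats-ranks-self zero    g X = refl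
  beats-ranks-self (suc m) g X rewrite ranks-suc m g X =
    beats-push-self (g Fin.zero) X _ (beats-ranks-self m (g ∘ Fin.suc) X)

  sum-push-partition : ∀ l {X Y Z} xs ys zs → δ l X + δ l Y + δ l Z ≡ 1 →
    sum xs ≡ beats xs xs + beats xs ys + beats xs zs →
    sum (push l X xs) ≡ beats (push l X xs) (push l X xs) + beats (push l X xs) (push l Y ys)
                          + beats (push l X xs) (push l Z zs)
  sum-push-partition l {X} {Y} {Z} xs ys zs partition split = begin
    sum (push l X xs)
      ≡⟨ sum-push l X xs ⟩
    a + sum xs
      ≡⟨ cong (a +_) split ⟩
    a + (beats xs xs + beats xs ys + beats xs zs)
      ≡⟨ cong (_+ (beats xs xs + beats xs ys + beats xs zs)) (*-identityˡ a) ⟨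
    1 * a + (beats xs xs + beats xs ys + beats xs zs)
      ≡⟨ cong (λ d → d * a + (beats xs xs + beats xs ys + beats xs zs)) partition ⟨
    (δ l X + δ l Y + δ l Z) * a + (beats xs xs + beats xs ys + beats xs zs)
      ≡⟨ distribute (δ l X) (δ l Y) (δ l Z) a (beats xs xs) (beats xs ys) (beats xs zs) ⟩
    (δ l X * a + beats xs xs) + (δ l Y * a + beats xs ys) + (δ l Z * a + beats xs zs)
      ≡⟨ cong₂ _+_ (cong₂ _+_ (beats-push l X X xs xs) (beats-push l X Y xs ys)) (beats-push l X Z xs zs) ⟨
    beats (push l X xs) (push l X xs) + beats (push l X xs) (push l Y ys) + beats (push l X xs) (push l Z zs) ∎
    where
    a : ℕ
    a = length xs
    distribute : ∀ d₁ d₂ d₃ a u v w →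
      (d₁ + d₂ + d₃) * a + (u + v + w) ≡ (d₁ * a + u) + (d₂ * a + v) + (d₃ * a + w)
    distribute = solve-∀

  sum-ranks-partition : ∀ m g {X Y Z} → (∀ l → δ l X + δ l Y + δ l Z ≡ 1) →
    sum (ranks m g X) ≡ beats (ranks m g X) (ranks m g X) + beats (ranks m g X) (ranks m g Y)
                          + beats (ranks m g X) (ranks m g Z)
  sum-ranks-partition zero    g partition = refl
  sum-ranks-partition (suc m) g {X} {Y} {Z} partition
    rewrite ranks-suc m g X | ranks-suc m g Y | ranks-suc m g Z =
      sum-push-partition (g Fin.zero) _ _ _ (partition (g Fin.zero))
        (sum-ranks-partition m (g ∘ Fin.suc) partition)

open Labelling _≟D_

next : Die → Die
next A = B
next B = C
next C = A

next²≢ : ∀ X → next (next X) ≢ X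
next²≢ A ()
next²≢ B ()
next²≢ C ()

δ-cycle : ∀ l X → δ l X + δ l (next X) + δ l (next (next X)) ≡ 1
δ-cycle A A = refl
δ-cycle A B = refl
δ-cycle A C = refl
δ-cycle B A = refl
δ-cycle B B = refl
δ-cycle B C = refl
δ-cycle C A = refl
δ-cycle C B = refl
δ-cycle C C = refl

cyclic-balance : ∀ {M s₁ s₂ s₃ p q r} →
  s₁ + r ≡ M + p → s₂ + p ≡ M + q → s₃ + q ≡ M + r →
  (p ≡ q × q ≡ r) ⇔ (s₁ ≡ s₂ × s₂ ≡ s₃)
cyclic-balance {M} {s₁} {s₂} {s₃} {p} {q} {r} e₁ e₂ e₃ = mk⇔ equal-sums equal-wins
  where
  equal-sums : p ≡ q × q ≡ r → s₁ ≡ s₂ × s₂ ≡ s₃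
  equal-sums (refl , refl) = trans (s≡M e₁) (sym (s≡M e₂)) , trans (s≡M e₂) (sym (s≡M e₃))
    where
    s≡M : ∀ {s} → s + p ≡ M + p → s ≡ M
    s≡M = +-cancelʳ-≡ p _ M

  equal-wins : s₁ ≡ s₂ × s₂ ≡ s₃ → p ≡ q × q ≡ r
  equal-wins (refl , refl) = +-cancelˡ-≡ M p q (subst (λ s → s + p ≡ M + q) s₁≡M e₂)
                           , +-cancelˡ-≡ M q r (subst (λ s → s + q ≡ M + r) s₁≡M e₃)
    where
    total : 3 * s₁ + (p + q + r) ≡ 3 * M + (p + q + r)
    total = begin
      3 * s₁ + (p + q + r)              ≡⟨ regroup s₁ p q r ⟩
      (s₁ + r) + (s₁ + p) + (s₁ + q)    ≡⟨ cong₂ _+_ (cong₂ _+_ e₁ e₂) e₃ ⟩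
      (M + p) + (M + q) + (M + r)       ≡⟨ regroup′ M p q r ⟩
      3 * M + (p + q + r) ∎
      where
      regroup : ∀ s p q r → 3 * s + (p + q + r) ≡ (s + r) + (s + p) + (s + q)
      regroup = solve-∀
      regroup′ : ∀ m p q r → (m + p) + (m + q) + (m + r) ≡ 3 * m + (p + q + r)
      regroup′ = solve-∀
    s₁≡M : s₁ ≡ M
    s₁≡M = *-cancelˡ-≡ s₁ M 3 (+-cancelʳ-≡ (p + q + r) _ _ total)

+[m]/d≡+[n]/d⇔m≡n : ∀ m n d {{_ : NonZero d}} → ((ℤ.+ m) / d ≡ (ℤ.+ n) / d) ⇔ (m ≡ n)
+[m]/d≡+[n]/d⇔m≡n m n d = mk⇔ (*-cancelʳ-≡ m n d ∘ normalize-injective-≃ m n d d) (cong (λ k → (ℤ.+ k) / d))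

faces≡map-suc-ranks : ∀ n f X → faces n f X ≡ map suc (ranks (3 * n) f X)
faces≡map-suc-ranks n f X = map-∘ (filter (λ i → f i ≟D X) (allFin (3 * n)))

length-faces : ∀ n f X → length (faces n f X) ≡ length (ranks (3 * n) f X)
length-faces n f X = trans (cong length (faces≡map-suc-ranks n f X)) (length-map suc (ranks (3 * n) f X))

faceSum-ranks : ∀ n f X → faceSum n f X ≡ length (ranks (3 * n) f X) + sum (ranks (3 * n) f X)
faceSum-ranks n f X = trans (cong sum (faces≡map-suc-ranks n f X)) (sum-map-suc (ranks (3 * n) f X))

wins-beats : ∀ n f X Y → wins n f X Y ≡ beats (ranks (3 * n) f X) (ranks (3 * n) f Y)
wins-beats n f X Y = begin
  wins n f X Y                                        ≡⟨ length-filter-cartesianProduct (faces n f X) (faces n f Y) ⟩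
  beats (faces n f X) (faces n f Y)                   ≡⟨ cong₂ beats (faces≡map-suc-ranks n f X) (faces≡map-suc-ranks n f Y) ⟩
  beats (map suc (ranks _ f X)) (map suc (ranks _ f Y)) ≡⟨ beats-map-suc (ranks _ f X) (ranks _ f Y) ⟩
  beats (ranks _ f X) (ranks _ f Y) ∎

balanced⇔equal-wins : ∀ n .{{_ : NonZero n}} f →
  Balanced n f ⇔ (wins n f A B ≡ wins n f B C × wins n f B C ≡ wins n f C A)
balanced⇔equal-wins n f = +[m]/d≡+[n]/d⇔m≡n _ _ (n * n) ×-⇔ +[m]/d≡+[n]/d⇔m≡n _ _ (n * n)
  where instance
  nonZero-n² : NonZero (n * n)
  nonZero-n² = m*n≢0 n n

faceSum-cycle : ∀ n f → (∀ X → length (ranks (3 * n) f X) ≡ n) → ∀ X →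
  faceSum n f X + wins n f (next (next X)) X ≡ (n + triangle n + n * n) + wins n f X (next X)
faceSum-cycle n f size X = begin
  faceSum n f X + wins n f Z X
    ≡⟨ cong₂ _+_ (faceSum-ranks n f X) (wins-beats n f Z X) ⟩
  length (r X) + sum (r X) + beats (r Z) (r X)
    ≡⟨ cong (λ s → length (r X) + s + beats (r Z) (r X)) (sum-ranks-partition (3 * n) f (λ l → δ-cycle l X)) ⟩
  length (r X) + (beats (r X) (r X) + beats (r X) (r Y) + beats (r X) (r Z)) + beats (r Z) (r X)
    ≡⟨ regroup (length (r X)) (beats (r X) (r X)) (beats (r X) (r Y)) (beats (r X) (r Z)) (beats (r Z) (r X)) ⟩
  length (r X) + beats (r X) (r X) + (beats (r X) (r Z) + beats (r Z) (r X)) + beats (r X) (r Y)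
    ≡⟨ cong (_+ beats (r X) (r Y)) (cong₂ _+_ (cong₂ _+_ (size X) self) complement) ⟩
  n + triangle n + n * n + beats (r X) (r Y)
    ≡⟨ cong (n + triangle n + n * n +_) (wins-beats n f X Y) ⟨
  n + triangle n + n * n + wins n f X Y ∎
  where
  r : Die → List ℕ
  r = ranks (3 * n) f
  Y Z : Die
  Y = next X
  Z = next (next X)
  self : beats (r X) (r X) ≡ triangle n
  self = trans (beats-ranks-self (3 * n) f X) (cong triangle (size X))
  complement : beats (r X) (r Z) + beats (r Z) (r X) ≡ n * n
  complement = trans (beats-ranks-complement (3 * n) f (next²≢ X ∘ sym)) (cong₂ _*_ (size X) (size Z))
  regroup : ∀ ℓ t p q q′ → ℓ + (t + p + q) + q′ ≡ ℓ + t + (q + q′) + p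
  regroup = solve-∀

theorem3p1 : (n : ℕ) .{{_ : NonZero n}} (f : Assignment n) → IsDiceSet n f →
    Balanced n f ⇔ EqualFaceSums n f
theorem3p1 n f dice = cyclic-balance (cycle A) (cycle B) (cycle C) ⇔-∘ balanced⇔equal-wins n f
  where
  open IsDiceSet dice
  size : ∀ X → length (ranks (3 * n) f X) ≡ n
  size A = trans (sym (length-faces n f A)) sizeA
  size B = trans (sym (length-faces n f B)) sizeB
  size C = trans (sym (length-faces n f C)) sizeC
  cycle : ∀ X → faceSum n f X + wins n f (next (next X)) X ≡ (n + triangle n + n * n) + wins n f X (next X)
  cycle = faceSum-cycle n f size
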